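{- Let $X=\{x_1,\dots,x_{10}\}\subset\mathbb{R}^2$ be in strong general position. Let $a,b,c,d,c',d' \in X$ be such that $a,b,c,d$ are pairwise distinct, $a,b,c',d'$ are pairwise distinct, $\{c,d\}\neq\{c',d'\}$, the points $y := y_{a,b,c,d}$ and $y' := y_{a,b,c',d'}$ are valid intersection points, and $\chi(a,b,c) = \chi(a,b,c')$. Let $i, j \in X$ be distinct points, distinct from $a,b,c',d'$, such that $\chi(a,b,i) = \chi(a,b,c) = \chi(a,b,c')$ and $\chi(a,b,j) = \chi(a,b,d) = \chi(a,b,d')$. Suppose that $\chi(i,j,y) \neq \chi(c',d',y)$ and $\chi(i,j,y') \neq 0$. Then \[ \chi(i,j,y') = \chi(c,d,y') = -\chi(c',d',y). \]
   Context: Strong general position in $\mathbb{R}^2$: every three points of $X$ are affinely independent, and for every collection $F_1,\dots,F_r$ of pairwise disjoint subsets of $X$ one has $2 - \dim \bigcap_i \operatorname{aff}(F_i) = \min(3, \sum_i (2 - \dim\operatorname{aff}(F_i)))$ (with $\dim\emptyset=-1$). For pairwise distinct $a,b,c,d\in X$, $y_{a,b,c,d}$ denotes the unique intersection point of the lines $ab$ and $cd$. For $p,q,r\in\mathbb{R}^2$, $\chi(p,q,r) := \operatorname{sign}\det(q-p,\,r-p)\in\{ -1,0,1\}$. The point $y_{a,b,c,d}$ is an intersection point if $\{y_{a,b,c,d}\} = \operatorname{conv}(a,b)\cap\operatorname{conv}(c,d)$; it is a valid intersection point if it is an intersection point and $2 \le |\{h\in X\setminus\{a,b,c,d\}\colon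 \chi(a,b,h)=1\}| \le 4$ and $2 \le |\{h\in X\setminus\{a,b,c,d\}\colon \chi(c,d,h)=1\}| \le 4$. -}

module Defs where

open import Level using (0ℓ)
open import Data.Nat as ℕ using (ℕ; zero; suc)
open import Data.Integer as ℤ using (ℤ; +_; -[1+_])
open import Data.Fin using (Fin; zero; suc)
open import Data.Fin.Subset using (Subset; _∈_; _∉_; _∩_; Empty)
open import Data.List as List using (List; []; _∷_; length; filter; map)
open import Data.List.Relation.Unary.All using (All)
open import Data.List.Relation.Unary.AllPairs using (AllPairs)
open import Data.List.Relation.Binary.Pointwise using (Pointwise)
open import Data.Product using (Σ; ∃; ∃-syntax; _×_; _,_)
open import Data.Sum using (_⊎_)
open import Relation.Nullary using (¬_; Dec; yes; no)
open import Relation.Nullary.Decidable using (_×-dec_; ¬?)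
open import Relation.Binary using (Tri; tri<; tri≈; tri>)
open import Relation.Binary.PropositionalEquality using (_≡_; _≢_)
open import Relation.Binary.Structures using (IsStrictTotalOrder)
open import Algebra.Structures using (IsCommutativeRing)
open import Data.Fin.Properties using () renaming (_≟_ to _≟ᶠ_)
open import Function using (Injective)
import Data.Fin.Properties as FinP
import Data.Integer.Properties as ℤP
import Data.List.Base

-- An abstract model of the real numbers: a Dedekind-complete ordered
-- field (this characterises ℝ up to isomorphism).  The stdlib has no reals.

record RealField : Set₁ where
  infixl 6 _+_ _-_
  infixl 7 _*_
  field
    Carrier : Set
    _+_ _*_ : Carrier → Carrier → Carrier
    -_      : Carrier → Carrier
    0# 1#   : Carrier
    _⁻¹     : Carrier → Carrier          -- total inverse (value at 0 irrelevant)
    _<_     : Carrier → Carrier → Set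
    isCommutativeRing : IsCommutativeRing _≡_ _+_ _*_ -_ 0# 1#
    0≢1     : 0# ≢ 1#
    ⁻¹-inverse : ∀ x → x ≢ 0# → x * (x ⁻¹) ≡ 1#
    isStrictTotalOrder : IsStrictTotalOrder _≡_ _<_
    +-mono-< : ∀ {x y} z → x < y → (x + z) < (y + z)
    *-pos    : ∀ {x y} → 0# < x → 0# < y → 0# < (x * y)
    sup : (P : Carrier → Set) → (∃ λ x → P x) →
          (∃ λ u → ∀ x → P x → (x < u ⊎ x ≡ u)) →
          ∃ λ s → (∀ x → P x → (x < s ⊎ x ≡ s)) ×
                  (∀ u → (∀ x → P x → (x < u ⊎ x ≡ u)) → (s < u ⊎ s ≡ u))

  _-_ : Carrier → Carrier → Carrier
  x - y = x + (- y)

  _≤_ : Carrier → Carrier → Set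
  x ≤ y = x < y ⊎ x ≡ y

  compare : ∀ x y → Tri (x < y) (x ≡ y) (y < x)
  compare = IsStrictTotalOrder.compare isStrictTotalOrder

module Geometry (R : RealField) where
  open RealField R

  Point : Set
  Point = Carrier × Carrier

  _⊕_ : Point → Point → Point
  (p₁ , p₂) ⊕ (q₁ , q₂) = (p₁ + q₁ , p₂ + q₂)

  _⊖_ : Point → Point → Point
  (p₁ , p₂) ⊖ (q₁ , q₂) = (p₁ - q₁ , p₂ - q₂)

  _·_ : Carrier → Point → Point
  t · (p₁ , p₂) = (t * p₁ , t * p₂)

  det : Point → Point → Carrier
  det (u₁ , u₂) (v₁ , v₂) = u₁ * v₂ - u₂ * v₁

  sign : Carrier → ℤ
  sign x with compare 0# x
  ... | tri< _ _ _ = + 1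
  ... | tri≈ _ _ _ = + 0
  ... | tri> _ _ _ = -[1+ 0 ]

  χ : Point → Point → Point → ℤ
  χ p q r = sign (det (q ⊖ p) (r ⊖ p))

  -- y_{a,b,c,d}: the intersection point of lines ab and cd
  -- (a + t(b-a) with t = det(c-a,d-c)/det(b-a,d-c)).
  yPt : Point → Point → Point → Point → Point
  yPt a b c d = a ⊕ ((det (c ⊖ a) (d ⊖ c) * (det (b ⊖ a) (d ⊖ c)) ⁻¹) · (b ⊖ a))

  InConv : Point → Point → Point → Set
  InConv p q z = ∃ λ t → 0# ≤ t × t ≤ 1# × z ≡ p ⊕ (t · (q ⊖ p))

  ∑ : ∀ {n} → (Fin n → Carrier) → Carrier
  ∑ {zero}  f = 0#
  ∑ {suc n} f = f zero + ∑ (λ i → f (suc i))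

  ∑ᵖ : ∀ {n} → (Fin n → Point) → Point
  ∑ᵖ {zero}  f = (0# , 0#)
  ∑ᵖ {suc n} f = f zero ⊕ ∑ᵖ (λ i → f (suc i))

  Aff : ∀ {n} → (Fin n → Point) → Subset n → Point → Set
  Aff x F z = ∃ λ (λs : _ → Carrier) →
    (∀ i → i ∉ F → λs i ≡ 0#) × ∑ λs ≡ 1# × z ≡ ∑ᵖ (λ i → λs i · x i)

  data HasDim (S : Point → Set) : ℤ → Set where
    dim-empty : (∀ z → ¬ S z) → HasDim S (-[1+ 0 ])
    dim-point : (p : Point) → (∀ z → (S z → z ≡ p) × (z ≡ p → S z)) → HasDim S (+ 0)
    dim-line  : (p q : Point) → p ≢ q →
                (∀ z → (S z → ∃ λ t → z ≡ p ⊕ (t · (q ⊖ p))) ×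
                       ((∃ λ t → z ≡ p ⊕ (t · (q ⊖ p))) → S z)) → HasDim S (+ 1)
    dim-plane : (∀ z → S z) → HasDim S (+ 2)

  sumℤ : List ℤ → ℤ
  sumℤ = List.foldr ℤ._+_ (+ 0)

  codim : ℤ → ℤ
  codim k = + 2 ℤ.- k

  -- Strong general position of x : Fin n → Point (x injective, X = image)
  record StrongGP {n : ℕ} (x : Fin n → Point) : Set where
    field
      distinct : Injective _≡_ _≡_ x
      affIndep : ∀ i j k → i ≢ j → j ≢ k → i ≢ k → χ (x i) (x j) (x k) ≢ + 0
      dimCond  : (Fs : List (Subset n)) → AllPairs (λ F G → Empty (F ∩ G)) Fs →
                 (ks : List ℤ) → Pointwise (λ F k → HasDim (Aff x F) k) Fs ks →
                 (k : ℤ) → HasDim (λ z → All (λ F → Aff x F z) Fs) k →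
                 codim k ≡ ℤ._⊓_ (+ 3) (sumℤ (map codim ks))

  module _ (x : Fin 10 → Point) where

    yI : Fin 10 → Fin 10 → Fin 10 → Fin 10 → Point
    yI a b c d = yPt (x a) (x b) (x c) (x d)

    χI : Fin 10 → Fin 10 → Fin 10 → ℤ
    χI p q r = χ (x p) (x q) (x r)

    IsIntersection : Fin 10 → Fin 10 → Fin 10 → Fin 10 → Set
    IsIntersection a b c d = ∀ z →
      ((InConv (x a) (x b) z × InConv (x c) (x d) z) → z ≡ yI a b c d) ×
      (z ≡ yI a b c d → (InConv (x a) (x b) z × InConv (x c) (x d) z))

    countPos : Fin 10 → Fin 10 → Fin 10 → Fin 10 → Fin 10 → Fin 10 → ℕ
    countPos a b c d p q = length (filter (λ h →
        ¬? (h ≟ᶠ a) ×-dec ¬? (h ≟ᶠ b) ×-dec ¬? (h ≟ᶠ c) ×-dec ¬? (h ≟ᶠ d)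
        ×-dec (χI p q h ℤP.≟ + 1))
      (Data.List.Base.allFin 10))

    IsValid : Fin 10 → Fin 10 → Fin 10 → Fin 10 → Set
    IsValid a b c d = IsIntersection a b c d ×
      (2 ℕ.≤ countPos a b c d a b × countPos a b c d a b ℕ.≤ 4) ×
      (2 ℕ.≤ countPos a b c d c d × countPos a b c d c d ℕ.≤ 4)

  PairwiseDistinct4 : ∀ {n} → Fin n → Fin n → Fin n → Fin n → Set
  PairwiseDistinct4 a b c d =
    a ≢ b × a ≢ c × a ≢ d × b ≢ c × b ≢ d × c ≢ d

-- Write y = a + l(b − a) and y′ = a + l′(b − a).  Moving a point along the line ab changes the
-- signed area of (p, q, ·) linearly in the parameter:
--   Δ(p, q, y′) = Δ(p, q, y) + (l′ − l)(Δ(a, b, p) − Δ(a, b, q)).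
-- For each of the pairs (c, d), (c′, d′), (i, j) the first point lies on the side s = χ(a, b, c)
-- of ab and the second on the side −s (for (c, d) because y ∈ conv(c, d) lies on ab), so the last
-- factor has sign s.  As y lies on cd and y′ on c′d′, this gives χ(c, d, y′) = σ and
-- χ(c′, d′, y) = −σ for σ = sign(l′ − l)·s, and χ(i, j, y′) = σ because the shift has sign σ while
-- χ(i, j, y) ≠ χ(c′, d′, y) = −σ.  Finally σ ≠ 0 because y ≠ y′: if the pairs share an endpoint,
-- the two lines through it meet only there, off ab; otherwise ab, cd, c′d′ would be three
-- concurrent lines, which strong general position forbids.

module Submission where

open import Defs
open import Level using (0ℓ)
open import Algebra.Bundles using (CommutativeRing; CommutativeMonoid; Ring)
open import Algebra.Solver.Ring.AlmostCommutativeRing using (fromCommutativeRing; _-Raw-AlmostCommutative⟶_)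
open import Data.Empty using (⊥; ⊥-elim)
open import Data.Fin using (Fin; zero; suc; punchIn; punchOut)
open import Data.Fin.Properties using (punchInᵢ≢i; punchIn-injective; punchIn-punchOut) renaming (_≟_ to _≟ᶠ_)
open import Data.Integer as ℤ using (ℤ; +_; -[1+_]; 0ℤ; 1ℤ; -1ℤ)
import Data.Integer.Properties as ℤ
open import Data.Maybe as Maybe using (Maybe)
import Data.Nat as ℕ
import Data.Nat.Properties as ℕ
open import Data.Product using (_×_; _,_; ∃; proj₁; proj₂)
open import Data.Sum as Sum using (_⊎_; inj₁; inj₂; [_,_]′)
open import Data.Fin.Subset using (Subset; ⁅_⁆; _∪_; _∩_; _∈_; _∉_; Empty)
open import Data.Fin.Subset.Properties using (x∈⁅x⁆; x∈⁅y⁆⇒x≡y; x∈p∪q⁻; x∈p∪q⁺; x∈p∩q⁻)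
open import Function using (_∘_)
open import Data.List using (_∷_; [])
open import Data.List.Relation.Unary.All using (All; _∷_; [])
open import Data.List.Relation.Unary.AllPairs using (AllPairs; _∷_; [])
open import Data.List.Relation.Binary.Pointwise using (Pointwise; _∷_; [])
open import Relation.Binary using (tri<; tri≈; tri>; IsStrictTotalOrder)
open import Relation.Binary.PropositionalEquality as ≡ using (_≡_; _≢_; refl; cong; cong₂; subst; subst₂)
open import Relation.Nullary using (¬_; yes; no)
open import Relation.Nullary.Decidable using (dec⇒maybe)

-- Algebra.Solver.Ring needs coefficients with decidable equality; ℤ maps into every commutative ring.
module IntegerCoefficientSolver {c ℓ} (R : CommutativeRing c ℓ) where
  open CommutativeRing R renaming (refl to ≈-refl)
  open import Algebra.Properties.Ring ring using (-‿involutive; -0#≈0#; -‿distribˡ-*; -‿distribʳ-*)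
  open import Algebra.Properties.AbelianGroup +-abelianGroup using (⁻¹-∙-comm)
  open import Algebra.Properties.CommutativeSemigroup +-commutativeSemigroup using (interchange)
  open import Algebra.Properties.Monoid.Mult.TCOptimised +-monoid using (×-homo-+; 1+×) renaming (_×_ to _×ᴿ_)
  open import Algebra.Properties.Semiring.Mult.TCOptimised semiring using (×1-homo-*)
  open import Relation.Binary.Reasoning.Setoid setoid

  -- The optimised multiplication makes fromℤ 1ℤ reduce to 1#, so that con 1ℤ matches 1# in goals.
  fromℤ : ℤ → Carrier
  fromℤ (+ n)      = n ×ᴿ 1#
  fromℤ (-[1+ n ]) = - (ℕ.suc n ×ᴿ 1#)

  fromℤ-‿ : ∀ i → fromℤ (ℤ.- i) ≈ - fromℤ i
  fromℤ-‿ (+ ℕ.zero)  = sym -0#≈0#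
  fromℤ-‿ (+ ℕ.suc n) = ≈-refl
  fromℤ-‿ -[1+ n ]    = sym (-‿involutive _)

  fromℤ-⊖ : ∀ m n → fromℤ (m ℤ.⊖ n) ≈ m ×ᴿ 1# - n ×ᴿ 1#
  fromℤ-⊖ ℕ.zero    ℕ.zero    = sym (-‿inverseʳ 0#)
  fromℤ-⊖ ℕ.zero    (ℕ.suc n) = sym (+-identityˡ _)
  fromℤ-⊖ (ℕ.suc m) ℕ.zero    = sym (trans (+-congˡ -0#≈0#) (+-identityʳ _))
  fromℤ-⊖ (ℕ.suc m) (ℕ.suc n) = begin
    fromℤ (ℕ.suc m ℤ.⊖ ℕ.suc n)        ≡⟨ ≡.cong fromℤ (ℤ.[1+m]⊖[1+n]≡m⊖n m n) ⟩
    fromℤ (m ℤ.⊖ n)                    ≈⟨ fromℤ-⊖ m n ⟩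
    m ×ᴿ 1# - n ×ᴿ 1#                  ≈⟨ sym (+-identityˡ _) ⟩
    0# + (m ×ᴿ 1# - n ×ᴿ 1#)           ≈⟨ +-congʳ (sym (-‿inverseʳ 1#)) ⟩
    (1# - 1#) + (m ×ᴿ 1# - n ×ᴿ 1#)    ≈⟨ interchange _ _ _ _ ⟩
    (1# + m ×ᴿ 1#) + (- 1# - n ×ᴿ 1#)  ≈⟨ +-congˡ (⁻¹-∙-comm _ _) ⟩
    (1# + m ×ᴿ 1#) - (1# + n ×ᴿ 1#)    ≈⟨ +-cong (sym (1+× m 1#)) (-‿cong (sym (1+× n 1#))) ⟩
    ℕ.suc m ×ᴿ 1# - ℕ.suc n ×ᴿ 1#      ∎

  fromℤ-+ : ∀ i j → fromℤ (i ℤ.+ j) ≈ fromℤ i + fromℤ j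
  fromℤ-+ (+ m)    (+ n)    = ×-homo-+ 1# m n
  fromℤ-+ (+ m)    -[1+ n ] = fromℤ-⊖ m (ℕ.suc n)
  fromℤ-+ -[1+ m ] (+ n)    = trans (fromℤ-⊖ n (ℕ.suc m)) (+-comm _ _)
  fromℤ-+ -[1+ m ] -[1+ n ] = begin
    - (ℕ.suc (ℕ.suc (m ℕ.+ n)) ×ᴿ 1#)  ≡⟨ ≡.cong (λ k → - (ℕ.suc k ×ᴿ 1#)) (≡.sym (ℕ.+-suc m n)) ⟩
    - ((ℕ.suc m ℕ.+ ℕ.suc n) ×ᴿ 1#)    ≈⟨ -‿cong (×-homo-+ 1# (ℕ.suc m) (ℕ.suc n)) ⟩
    - (ℕ.suc m ×ᴿ 1# + ℕ.suc n ×ᴿ 1#)  ≈⟨ sym (⁻¹-∙-comm _ _) ⟩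
    - (ℕ.suc m ×ᴿ 1#) - ℕ.suc n ×ᴿ 1#  ∎

  fromℤ-*ℕ : ∀ m n → fromℤ (+ m ℤ.* + n) ≈ fromℤ (+ m) * fromℤ (+ n)
  fromℤ-*ℕ m n = trans (reflexive (≡.cong fromℤ (≡.sym (ℤ.pos-* m n)))) (×1-homo-* m n)

  fromℤ-*-negˡ : ∀ i j → fromℤ (i ℤ.* j) ≈ fromℤ i * fromℤ j →
                 fromℤ (ℤ.- i ℤ.* j) ≈ fromℤ (ℤ.- i) * fromℤ j
  fromℤ-*-negˡ i j h = begin
    fromℤ (ℤ.- i ℤ.* j)      ≡⟨ ≡.cong fromℤ (≡.sym (ℤ.neg-distribˡ-* i j)) ⟩
    fromℤ (ℤ.- (i ℤ.* j))    ≈⟨ fromℤ-‿ (i ℤ.* j) ⟩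
    - fromℤ (i ℤ.* j)        ≈⟨ -‿cong h ⟩
    - (fromℤ i * fromℤ j)    ≈⟨ -‿distribˡ-* _ _ ⟩
    - fromℤ i * fromℤ j      ≈⟨ *-congʳ (sym (fromℤ-‿ i)) ⟩
    fromℤ (ℤ.- i) * fromℤ j  ∎

  fromℤ-*-negʳ : ∀ i j → fromℤ (i ℤ.* j) ≈ fromℤ i * fromℤ j →
                 fromℤ (i ℤ.* ℤ.- j) ≈ fromℤ i * fromℤ (ℤ.- j)
  fromℤ-*-negʳ i j h = begin
    fromℤ (i ℤ.* ℤ.- j)      ≡⟨ ≡.cong fromℤ (≡.sym (ℤ.neg-distribʳ-* i j)) ⟩
    fromℤ (ℤ.- (i ℤ.* j))    ≈⟨ fromℤ-‿ (i ℤ.* j) ⟩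
    - fromℤ (i ℤ.* j)        ≈⟨ -‿cong h ⟩
    - (fromℤ i * fromℤ j)    ≈⟨ -‿distribʳ-* _ _ ⟩
    fromℤ i * - fromℤ j      ≈⟨ *-congˡ (sym (fromℤ-‿ j)) ⟩
    fromℤ i * fromℤ (ℤ.- j)  ∎

  fromℤ-* : ∀ i j → fromℤ (i ℤ.* j) ≈ fromℤ i * fromℤ j
  fromℤ-* (+ m)    (+ n)    = fromℤ-*ℕ m n
  fromℤ-* -[1+ m ] (+ n)    = fromℤ-*-negˡ (+ ℕ.suc m) (+ n) (fromℤ-*ℕ (ℕ.suc m) n)
  fromℤ-* (+ m)    -[1+ n ] = fromℤ-*-negʳ (+ m) (+ ℕ.suc n) (fromℤ-*ℕ m (ℕ.suc n))
  fromℤ-* -[1+ m ] -[1+ n ] =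
    fromℤ-*-negˡ (+ ℕ.suc m) -[1+ n ] (fromℤ-*-negʳ (+ ℕ.suc m) (+ ℕ.suc n) (fromℤ-*ℕ (ℕ.suc m) (ℕ.suc n)))

  ℤ-embedding : Ring.rawRing ℤ.+-*-ring -Raw-AlmostCommutative⟶ fromCommutativeRing R
  ℤ-embedding = record
    { ⟦_⟧ = fromℤ ; +-homo = fromℤ-+ ; *-homo = fromℤ-* ; -‿homo = fromℤ-‿
    ; 0-homo = ≈-refl ; 1-homo = ≈-refl
    }

  fromℤ-≟ : ∀ i j → Maybe (fromℤ i ≈ fromℤ j)
  fromℤ-≟ i j = Maybe.map (reflexive ∘ ≡.cong fromℤ) (dec⇒maybe (i ℤ.≟ j))

  open import Algebra.Solver.Ring _ _ ℤ-embedding fromℤ-≟ public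
    using (solve; _:=_; _:+_; _:*_; _:-_; :-_; con; Polynomial)

module FiniteSupport {c ℓ} (M : CommutativeMonoid c ℓ) where
  open CommutativeMonoid M renaming (_∙_ to _+_; ε to 0#; ∙-congˡ to +-congˡ; identityʳ to +-identityʳ)
  open import Algebra.Properties.CommutativeMonoid.Sum M using (sum; sum-remove; sum-cong-≋; sum-replicate-zero)
  open import Relation.Binary.Reasoning.Setoid setoid

  sum-supported-at : ∀ {n} (f : Fin n → Carrier) p → (∀ i → i ≢ p → f i ≈ 0#) → sum f ≈ f p
  sum-supported-at {ℕ.suc n} f p vanish = begin
    sum f                      ≈⟨ sum-remove f ⟩
    f p + sum (f ∘ punchIn p)  ≈⟨ +-congˡ (trans (sum-cong-≋ (vanish _ ∘ punchInᵢ≢i p)) (sum-replicate-zero n)) ⟩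
    f p + 0#                   ≈⟨ +-identityʳ _ ⟩
    f p                        ∎

  sum-supported-at-pair : ∀ {n} (f : Fin n → Carrier) {p q} → p ≢ q →
                          (∀ i → i ≢ p → i ≢ q → f i ≈ 0#) → sum f ≈ f p + f q
  sum-supported-at-pair {ℕ.suc n} f {p} {q} p≢q vanish = begin
    sum f                               ≈⟨ sum-remove f ⟩
    f p + sum (f ∘ punchIn p)           ≈⟨ +-congˡ (sum-supported-at (f ∘ punchIn p) (punchOut p≢q) vanish′) ⟩
    f p + f (punchIn p (punchOut p≢q))  ≡⟨ cong (λ k → f p + f k) (punchIn-punchOut p≢q) ⟩
    f p + f q                           ∎
    where
    vanish′ : ∀ j → j ≢ punchOut p≢q → f (punchIn p j) ≈ 0#
    vanish′ j j≢ = vanish _ (punchInᵢ≢i p j)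
      (λ e → j≢ (punchIn-injective p j _ (≡.trans e (≡.sym (punchIn-punchOut p≢q)))))

commutativeRing : RealField → CommutativeRing 0ℓ 0ℓ
commutativeRing R = record { isCommutativeRing = RealField.isCommutativeRing R }

module Signs (R : RealField) where
  open RealField R
  open Geometry R using (sign)
  open CommutativeRing (commutativeRing R)
    using (+-identityˡ; +-identityʳ; -‿inverseˡ; -‿inverseʳ; zeroˡ; zeroʳ; *-comm; ring)
  open import Algebra.Properties.Ring ring using (-0#≈0#; -‿distribʳ-*)
  open IsStrictTotalOrder isStrictTotalOrder using (irrefl) renaming (trans to <-trans)
  open IntegerCoefficientSolver (commutativeRing R) using (solve; _:=_; _:+_; _:*_; _:-_; :-_; con)

  data Sgn (u : Carrier) : ℤ → Set where
    positive  : 0# < u → Sgn u 1ℤ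
    vanishing : u ≡ 0# → Sgn u 0ℤ
    negative  : u < 0# → Sgn u -1ℤ

  sgn : ∀ u → Sgn u (sign u)
  sgn u with compare 0# u
  ... | tri< 0<u _ _ = positive 0<u
  ... | tri≈ _ 0≡u _ = vanishing (≡.sym 0≡u)
  ... | tri> _ _ u<0 = negative u<0

  Sgn-unique : ∀ {u s t} → Sgn u s → Sgn u t → s ≡ t
  Sgn-unique (positive _)  (positive _)  = refl
  Sgn-unique (vanishing _) (vanishing _) = refl
  Sgn-unique (negative _)  (negative _)  = refl
  Sgn-unique (positive p)  (vanishing e) = ⊥-elim (irrefl (≡.sym e) p)
  Sgn-unique (positive p)  (negative n)  = ⊥-elim (irrefl refl (<-trans p n))
  Sgn-unique (vanishing e) (positive p)  = ⊥-elim (irrefl (≡.sym e) p)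
  Sgn-unique (vanishing e) (negative n)  = ⊥-elim (irrefl e n)
  Sgn-unique (negative n)  (positive p)  = ⊥-elim (irrefl refl (<-trans p n))
  Sgn-unique (negative n)  (vanishing e) = ⊥-elim (irrefl e n)

  Sgn⇒sign : ∀ {u s} → Sgn u s → sign u ≡ s
  Sgn⇒sign = Sgn-unique (sgn _)

  sign⇒Sgn : ∀ {u s} → sign u ≡ s → Sgn u s
  sign⇒Sgn {u} e = subst (Sgn u) e (sgn u)

  Sgn-0ℤ : ∀ {u} → Sgn u 0ℤ → u ≡ 0#
  Sgn-0ℤ (vanishing e) = e

  neg-<0 : ∀ {u} → 0# < u → (- u) < 0#
  neg-<0 {u} p = subst₂ _<_ (+-identityˡ (- u)) (-‿inverseʳ u) (+-mono-< (- u) p)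

  neg->0 : ∀ {u} → u < 0# → 0# < (- u)
  neg->0 {u} n = subst₂ _<_ (-‿inverseʳ u) (+-identityˡ (- u)) (+-mono-< (- u) n)

  neg->0⁻¹ : ∀ {u} → 0# < (- u) → u < 0#
  neg->0⁻¹ {u} p = subst₂ _<_ (+-identityˡ u) (-‿inverseˡ u) (+-mono-< u p)

  Sgn-‿ : ∀ {u s} → Sgn u s → Sgn (- u) (ℤ.- s)
  Sgn-‿ (positive p)  = negative (neg-<0 p)
  Sgn-‿ (vanishing e) = vanishing (≡.trans (cong -_ e) -0#≈0#)
  Sgn-‿ (negative n)  = positive (neg->0 n)

  Sgn-+ : ∀ {u v s} → Sgn u s → Sgn v s → Sgn (u + v) s
  Sgn-+ {u} {v} (positive p) (positive q) =
    positive (<-trans q (subst (_< (u + v)) (+-identityˡ v) (+-mono-< v p)))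
  Sgn-+ {u} {v} (vanishing e) (vanishing f) =
    vanishing (≡.trans (cong₂ _+_ e f) (+-identityˡ 0#))
  Sgn-+ {u} {v} (negative n) (negative m) =
    negative (<-trans (subst ((u + v) <_) (+-identityˡ v) (+-mono-< v n)) m)

  pos*neg<0 : ∀ {u v} → 0# < u → v < 0# → (u * v) < 0#
  pos*neg<0 {u} {v} p n = neg->0⁻¹ (subst (0# <_) (≡.sym (-‿distribʳ-* u v)) (*-pos p (neg->0 n)))

  Sgn-* : ∀ {u v s t} → Sgn u s → Sgn v t → Sgn (u * v) (s ℤ.* t)
  Sgn-* (positive p)  (positive q)  = positive (*-pos p q)
  Sgn-* (positive p)  (negative n)  = negative (pos*neg<0 p n)
  Sgn-* {u} {v} (negative n) (positive p) = negative (subst (_< 0#) (*-comm v u) (pos*neg<0 p n))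
  Sgn-* {u} {v} (negative n) (negative m) =
    positive (subst (0# <_) (solve 2 (λ u v → :- u :* :- v := u :* v) refl u v) (*-pos (neg->0 n) (neg->0 m)))
  Sgn-* {u} {v} (vanishing e) _ = vanishing (≡.trans (cong (_* v) e) (zeroˡ v))
  Sgn-* {u} {v} (positive _)  (vanishing f) = vanishing (≡.trans (cong (u *_) f) (zeroʳ u))
  Sgn-* {u} {v} (negative _)  (vanishing f) = vanishing (≡.trans (cong (u *_) f) (zeroʳ u))

  Sgn-scale : ∀ {w u s} → 0# < w → Sgn u s → Sgn (w * u) s
  Sgn-scale {s = s} p h = subst (Sgn _) (ℤ.*-identityˡ s) (Sgn-* (positive p) h)

  Sgn-convex : ∀ {t u v s} → 0# ≤ t → t ≤ 1# → Sgn u s → Sgn v s → Sgn ((1# - t) * u + t * v) s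
  Sgn-convex {u = u} {v} {s} (inj₂ refl) _ hu _ =
    subst (λ w → Sgn w s) (solve 2 (λ u v → u := (con 1ℤ :- con 0ℤ) :* u :+ con 0ℤ :* v) refl u v) hu
  Sgn-convex {u = u} {v} {s} (inj₁ _) (inj₂ refl) _ hv =
    subst (λ w → Sgn w s) (solve 2 (λ u v → v := (con 1ℤ :- con 1ℤ) :* u :+ con 1ℤ :* v) refl u v) hv
  Sgn-convex {t} (inj₁ 0<t) (inj₁ t<1) hu hv = Sgn-+ (Sgn-scale 0<1-t hu) (Sgn-scale 0<t hv)
    where
    0<1-t : 0# < (1# - t)
    0<1-t = subst (_< (1# - t)) (-‿inverseʳ t) (+-mono-< (- t) t<1)

  sign-* : ∀ u v → sign (u * v) ≡ sign u ℤ.* sign v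
  sign-* u v = Sgn⇒sign (Sgn-* (sgn u) (sgn v))

  sign-‿ : ∀ u → sign (- u) ≡ ℤ.- sign u
  sign-‿ u = Sgn⇒sign (Sgn-‿ (sgn u))

  sign≡0⇒≡0 : ∀ {u} → sign u ≡ 0ℤ → u ≡ 0#
  sign≡0⇒≡0 e = Sgn-0ℤ (sign⇒Sgn e)

  ≡0⇒sign≡0 : ∀ {u} → u ≡ 0# → sign u ≡ 0ℤ
  ≡0⇒sign≡0 e = Sgn⇒sign (vanishing e)

  sign-difference : ∀ {u v s} → sign u ≡ s → sign v ≡ ℤ.- s → sign (u - v) ≡ s
  sign-difference {v = v} {s} e f =
    Sgn⇒sign (Sgn-+ (sign⇒Sgn e) (subst (Sgn (- v)) (ℤ.neg-involutive s) (Sgn-‿ (sign⇒Sgn f))))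

  Sgn-+-dominant : ∀ {u v s} → Sgn v s → s ≢ 0ℤ → sign u ≢ ℤ.- s → Sgn (u + v) s
  Sgn-+-dominant {u} {v} hv s≢0 u≢-s with sign u | sgn u | hv
  ... | _ | vanishing e | _ = subst (λ w → Sgn w _) (≡.sym (≡.trans (cong (_+ v) e) (+-identityˡ v))) hv
  ... | _ | _          | vanishing _ = ⊥-elim (s≢0 refl)
  ... | _ | positive p | positive q  = Sgn-+ (positive p) (positive q)
  ... | _ | negative n | negative m  = Sgn-+ (negative n) (negative m)
  ... | _ | positive _ | negative _  = ⊥-elim (u≢-s refl)
  ... | _ | negative _ | positive _  = ⊥-elim (u≢-s refl)

  sign-+-dominant : ∀ u v → sign v ≢ 0ℤ → sign u ≢ ℤ.- sign v → sign (u + v) ≡ sign v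
  sign-+-dominant u v v≢0 u≢-v = Sgn⇒sign (Sgn-+-dominant (sgn v) v≢0 u≢-v)

  convex≢0 : ∀ {t u v s} → 0# ≤ t → t ≤ 1# → Sgn u s → Sgn v s → s ≢ 0ℤ → (1# - t) * u + t * v ≢ 0#
  convex≢0 0≤t t≤1 hu hv s≢0 e =
    s≢0 (Sgn-unique (subst (λ w → Sgn w _) e (Sgn-convex 0≤t t≤1 hu hv)) (vanishing refl))

  convex≡0⇒opposite-signs : ∀ {t u v} → 0# ≤ t → t ≤ 1# → (1# - t) * u + t * v ≡ 0# →
                            sign u ≢ 0ℤ → sign v ≢ 0ℤ → sign v ≡ ℤ.- sign u
  convex≡0⇒opposite-signs {u = u} {v} 0≤t t≤1 e u≢0 v≢0 with sign u | sgn u | sign v | sgn v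
  ... | _ | vanishing _ | _ | _ = ⊥-elim (u≢0 refl)
  ... | _ | _ | _ | vanishing _ = ⊥-elim (v≢0 refl)
  ... | _ | positive _ | _ | negative _ = refl
  ... | _ | negative _ | _ | positive _ = refl
  ... | _ | positive p | _ | positive q = ⊥-elim (convex≢0 0≤t t≤1 (positive p) (positive q) (λ ()) e)
  ... | _ | negative n | _ | negative m = ⊥-elim (convex≢0 0≤t t≤1 (negative n) (negative m) (λ ()) e)

module Plane (R : RealField) where
  open RealField R
  open Geometry R
  open Signs R
  open IntegerCoefficientSolver (commutativeRing R)
  open CommutativeRing (commutativeRing R) using (*-comm; *-assoc; *-identityˡ; +-identityˡ; zeroʳ; -‿inverseʳ; ring)
  open import Algebra.Properties.Ring ring using (x∙y⁻¹≈ε⇒x≈y; ⁻¹-anti-homo‿-; -0#≈0#)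
  open ≡.≡-Reasoning

  Δ : Point → Point → Point → Carrier
  Δ p q r = det (q ⊖ p) (r ⊖ p)

  along : Point → Point → Carrier → Point
  along p q t = p ⊕ (t · (q ⊖ p))

  OnLine : Point → Point → Point → Set
  OnLine p q z = ∃ λ t → z ≡ along p q t

  private
    Pointᴾ : ℕ.ℕ → Set
    Pointᴾ k = Polynomial k × Polynomial k

    _⊕ᴾ_ _⊖ᴾ_ : ∀ {k} → Pointᴾ k → Pointᴾ k → Pointᴾ k
    (p₁ , p₂) ⊕ᴾ (q₁ , q₂) = (p₁ :+ q₁ , p₂ :+ q₂)
    (p₁ , p₂) ⊖ᴾ (q₁ , q₂) = (p₁ :- q₁ , p₂ :- q₂)

    _·ᴾ_ : ∀ {k} → Polynomial k → Pointᴾ k → Pointᴾ k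
    t ·ᴾ (p₁ , p₂) = (t :* p₁ , t :* p₂)

    detᴾ : ∀ {k} → Pointᴾ k → Pointᴾ k → Polynomial k
    detᴾ (u₁ , u₂) (v₁ , v₂) = u₁ :* v₂ :- u₂ :* v₁

    Δᴾ : ∀ {k} → Pointᴾ k → Pointᴾ k → Pointᴾ k → Polynomial k
    Δᴾ p q r = detᴾ (q ⊖ᴾ p) (r ⊖ᴾ p)

    alongᴾ : ∀ {k} → Pointᴾ k → Pointᴾ k → Polynomial k → Pointᴾ k
    alongᴾ p q t = p ⊕ᴾ (t ·ᴾ (q ⊖ᴾ p))

  Δ-self : ∀ p q → Δ p q p ≡ 0#
  Δ-self (p₁ , p₂) (q₁ , q₂) =
    solve 4 (λ p₁ p₂ q₁ q₂ → Δᴾ (p₁ , p₂) (q₁ , q₂) (p₁ , p₂) := con 0ℤ) refl p₁ p₂ q₁ q₂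

  Δ-along : ∀ p q t → Δ p q (along p q t) ≡ 0#
  Δ-along (p₁ , p₂) (q₁ , q₂) t =
    solve 5 (λ p₁ p₂ q₁ q₂ t → Δᴾ (p₁ , p₂) (q₁ , q₂) (alongᴾ (p₁ , p₂) (q₁ , q₂) t) := con 0ℤ)
      refl p₁ p₂ q₁ q₂ t

  Δ-swap : ∀ p q z → Δ p q z ≡ - Δ q p z
  Δ-swap (p₁ , p₂) (q₁ , q₂) (z₁ , z₂) =
    solve 6 (λ p₁ p₂ q₁ q₂ z₁ z₂ →
      Δᴾ (p₁ , p₂) (q₁ , q₂) (z₁ , z₂) := :- Δᴾ (q₁ , q₂) (p₁ , p₂) (z₁ , z₂))
      refl p₁ p₂ q₁ q₂ z₁ z₂

  OnLine⇒Δ≡0 : ∀ {p q z} → OnLine p q z → Δ p q z ≡ 0#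
  OnLine⇒Δ≡0 {p} {q} (t , refl) = Δ-along p q t

  Δ≡0-swap : ∀ {p q z} → Δ p q z ≡ 0# → Δ q p z ≡ 0#
  Δ≡0-swap {p} {q} {z} e = ≡.trans (Δ-swap q p z) (≡.trans (cong -_ e) -0#≈0#)

  Δ-along-convex : ∀ a b c d t → Δ a b (along c d t) ≡ (1# - t) * Δ a b c + t * Δ a b d
  Δ-along-convex (a₁ , a₂) (b₁ , b₂) (c₁ , c₂) (d₁ , d₂) t =
    solve 9 (λ a₁ a₂ b₁ b₂ c₁ c₂ d₁ d₂ t →
      let a = (a₁ , a₂); b = (b₁ , b₂); c = (c₁ , c₂); d = (d₁ , d₂) in
      Δᴾ a b (alongᴾ c d t) := (con 1ℤ :- t) :* Δᴾ a b c :+ t :* Δᴾ a b d)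
      refl a₁ a₂ b₁ b₂ c₁ c₂ d₁ d₂ t

  Δ-along-shift : ∀ a b p q l m → Δ p q (along a b l) ≡ Δ p q (along a b m) + (l - m) * (Δ a b p - Δ a b q)
  Δ-along-shift (a₁ , a₂) (b₁ , b₂) (p₁ , p₂) (q₁ , q₂) l m =
    solve 10 (λ a₁ a₂ b₁ b₂ p₁ p₂ q₁ q₂ l m →
      let a = (a₁ , a₂); b = (b₁ , b₂); p = (p₁ , p₂); q = (q₁ , q₂) in
      Δᴾ p q (alongᴾ a b l) := Δᴾ p q (alongᴾ a b m) :+ (l :- m) :* (Δᴾ a b p :- Δᴾ a b q))
      refl a₁ a₂ b₁ b₂ p₁ p₂ q₁ q₂ l m

  det-directions : ∀ a b c d → det (b ⊖ a) (d ⊖ c) ≡ - (Δ a b c - Δ a b d)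
  det-directions (a₁ , a₂) (b₁ , b₂) (c₁ , c₂) (d₁ , d₂) =
    solve 8 (λ a₁ a₂ b₁ b₂ c₁ c₂ d₁ d₂ →
      let a = (a₁ , a₂); b = (b₁ , b₂); c = (c₁ , c₂); d = (d₁ , d₂) in
      detᴾ (b ⊖ᴾ a) (d ⊖ᴾ c) := :- (Δᴾ a b c :- Δᴾ a b d))
      refl a₁ a₂ b₁ b₂ c₁ c₂ d₁ d₂

  Δ-difference : ∀ p q z y → Δ p q z - Δ p q y ≡ det (q ⊖ p) (z ⊖ y)
  Δ-difference (p₁ , p₂) (q₁ , q₂) (z₁ , z₂) (y₁ , y₂) =
    solve 8 (λ p₁ p₂ q₁ q₂ z₁ z₂ y₁ y₂ →
      let p = (p₁ , p₂); q = (q₁ , q₂); z = (z₁ , z₂); y = (y₁ , y₂) in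
      Δᴾ p q z :- Δᴾ p q y := detᴾ (q ⊖ᴾ p) (z ⊖ᴾ y))
      refl p₁ p₂ q₁ q₂ z₁ z₂ y₁ y₂

  cramer : ∀ u v w → (det u v · w) ≡ (det u w · v) ⊖ (det v w · u)
  cramer (u₁ , u₂) (v₁ , v₂) (w₁ , w₂) = cong₂ _,_
    (solve 6 (λ u₁ u₂ v₁ v₂ w₁ w₂ → let u = (u₁ , u₂); v = (v₁ , v₂); w = (w₁ , w₂) in
      detᴾ u v :* w₁ := detᴾ u w :* v₁ :- detᴾ v w :* u₁)
      refl u₁ u₂ v₁ v₂ w₁ w₂)
    (solve 6 (λ u₁ u₂ v₁ v₂ w₁ w₂ → let u = (u₁ , u₂); v = (v₁ , v₂); w = (w₁ , w₂) in
      detᴾ u v :* w₂ := detᴾ u w :* v₂ :- detᴾ v w :* u₂)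
      refl u₁ u₂ v₁ v₂ w₁ w₂)

  affine-pair : ∀ p q {u v} → u + v ≡ 1# → (u · p) ⊕ (v · q) ≡ along p q v
  affine-pair (p₁ , p₂) (q₁ , q₂) {u} {v} u+v≡1 = cong₂ _,_ (coordinate p₁ q₁) (coordinate p₂ q₂)
    where
    coordinate : ∀ pₖ qₖ → u * pₖ + v * qₖ ≡ pₖ + v * (qₖ - pₖ)
    coordinate pₖ qₖ = begin
      u * pₖ + v * qₖ               ≡⟨ solve 4 (λ u v pₖ qₖ → u :* pₖ :+ v :* qₖ := (u :+ v) :* pₖ :+ v :* (qₖ :- pₖ))
                                                refl u v pₖ qₖ ⟩
      (u + v) * pₖ + v * (qₖ - pₖ)  ≡⟨ cong (λ w → w * pₖ + v * (qₖ - pₖ)) u+v≡1 ⟩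
      1# * pₖ + v * (qₖ - pₖ)       ≡⟨ cong (_+ v * (qₖ - pₖ)) (*-identityˡ pₖ) ⟩
      pₖ + v * (qₖ - pₖ)            ∎

  *≡0⇒≡0 : ∀ {u v} → u ≢ 0# → u * v ≡ 0# → v ≡ 0#
  *≡0⇒≡0 {u} {v} u≢0 uv≡0 = begin
    v               ≡⟨ solve 1 (λ v → v := con 1ℤ :* v) refl v ⟩
    1# * v          ≡⟨ cong (_* v) (≡.sym (≡.trans (*-comm _ _) (⁻¹-inverse u u≢0))) ⟩
    (u ⁻¹ * u) * v  ≡⟨ *-assoc _ _ _ ⟩
    u ⁻¹ * (u * v)  ≡⟨ cong (u ⁻¹ *_) uv≡0 ⟩
    u ⁻¹ * 0#       ≡⟨ zeroʳ _ ⟩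
    0#              ∎

  parallel-to-both⇒zero : ∀ {u v} w → det u v ≢ 0# → det u w ≡ 0# → det v w ≡ 0# → w ≡ (0# , 0#)
  parallel-to-both⇒zero {u} {v} w uv≢0 uw≡0 vw≡0 =
    cong₂ _,_ (*≡0⇒≡0 uv≢0 (cong proj₁ scaled≡0)) (*≡0⇒≡0 uv≢0 (cong proj₂ scaled≡0))
    where
    zero-scaled-difference : ∀ vₖ uₖ → 0# * vₖ - 0# * uₖ ≡ 0#
    zero-scaled-difference = solve 2 (λ vₖ uₖ → con 0ℤ :* vₖ :- con 0ℤ :* uₖ := con 0ℤ) refl
    scaled≡0 : (det u v · w) ≡ (0# , 0#)
    scaled≡0 = begin
      det u v · w                    ≡⟨ cramer u v w ⟩
      (det u w · v) ⊖ (det v w · u)  ≡⟨ cong₂ (λ s t → (s · v) ⊖ (t · u)) uw≡0 vw≡0 ⟩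
      (0# · v) ⊖ (0# · u)            ≡⟨ cong₂ _,_ (zero-scaled-difference _ _) (zero-scaled-difference _ _) ⟩
      (0# , 0#)                      ∎

  meet-unique : ∀ {p q p′ q′ z y} → det (q ⊖ p) (q′ ⊖ p′) ≢ 0# →
                Δ p q z ≡ 0# → Δ p′ q′ z ≡ 0# → Δ p q y ≡ 0# → Δ p′ q′ y ≡ 0# → z ≡ y
  meet-unique {p} {q} {p′} {q′} {z₁ , z₂} {y₁ , y₂} nonparallel pqz p′q′z pqy p′q′y =
    cong₂ _,_ (x∙y⁻¹≈ε⇒x≈y _ _ (cong proj₁ z-y≡0)) (x∙y⁻¹≈ε⇒x≈y _ _ (cong proj₂ z-y≡0))
    where
    parallel : ∀ {s t} → Δ s t (z₁ , z₂) ≡ 0# → Δ s t (y₁ , y₂) ≡ 0# →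
               det (t ⊖ s) ((z₁ , z₂) ⊖ (y₁ , y₂)) ≡ 0#
    parallel {s} {t} stz sty = ≡.trans (≡.sym (Δ-difference s t _ _)) (≡.trans (cong₂ _-_ stz sty) (-‿inverseʳ 0#))
    z-y≡0 : (z₁ , z₂) ⊖ (y₁ , y₂) ≡ (0# , 0#)
    z-y≡0 = parallel-to-both⇒zero _ nonparallel (parallel pqz pqy) (parallel p′q′z p′q′y)

  meet-at-common-endpoint : ∀ {p q s z} → Δ p q s ≢ 0# → Δ p q z ≡ 0# → Δ p s z ≡ 0# → z ≡ p
  meet-at-common-endpoint {p} {q} {s} pqs≢0 pqz psz = meet-unique pqs≢0 pqz psz (Δ-self p q) (Δ-self p s)

  shift-sign : ∀ {a b p q s} l l′ → sign (Δ a b p - Δ a b q) ≡ s →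
               sign ((l′ - l) * (Δ a b p - Δ a b q)) ≡ sign (l′ - l) ℤ.* s
  shift-sign l l′ p-q≡s = ≡.trans (sign-* _ _) (cong (sign (l′ - l) ℤ.*_) p-q≡s)

  χ-along-from-line : ∀ {a b p q s} l l′ → Δ p q (along a b l) ≡ 0# → sign (Δ a b p - Δ a b q) ≡ s →
                      χ p q (along a b l′) ≡ sign (l′ - l) ℤ.* s
  χ-along-from-line {a} {b} {p} {q} l l′ pqy≡0 p-q≡s = begin
    χ p q (along a b l′)                ≡⟨ cong sign (Δ-along-shift a b p q l′ l) ⟩
    sign (Δ p q (along a b l) + shift)  ≡⟨ cong (λ t → sign (t + shift)) pqy≡0 ⟩
    sign (0# + shift)                   ≡⟨ cong sign (+-identityˡ shift) ⟩
    sign shift                          ≡⟨ shift-sign l l′ p-q≡s ⟩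
    sign (l′ - l) ℤ.* _                 ∎
    where
    shift = (l′ - l) * (Δ a b p - Δ a b q)

  χ-along-dominated : ∀ {a b p q s} l l′ → sign (Δ a b p - Δ a b q) ≡ s → sign (l′ - l) ℤ.* s ≢ 0ℤ →
                      χ p q (along a b l) ≢ ℤ.- (sign (l′ - l) ℤ.* s) →
                      χ p q (along a b l′) ≡ sign (l′ - l) ℤ.* s
  χ-along-dominated {a} {b} {p} {q} l l′ p-q≡s σ≢0 χ≢-σ = begin
    χ p q (along a b l′)                ≡⟨ cong sign (Δ-along-shift a b p q l′ l) ⟩
    sign (Δ p q (along a b l) + shift)  ≡⟨ sign-+-dominant _ shift (σ≢0 ∘ ≡.trans (≡.sym σ))
                                                               (χ≢-σ ∘ λ e → ≡.trans e (cong ℤ.-_ σ)) ⟩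
    sign shift                          ≡⟨ σ ⟩
    sign (l′ - l) ℤ.* _                 ∎
    where
    shift = (l′ - l) * (Δ a b p - Δ a b q)
    σ = shift-sign l l′ p-q≡s

  orientations-at-two-crossings : ∀ {a b c d c′ d′ i j s} l l′ → s ≢ 0ℤ → l′ ≢ l →
    sign (Δ a b c - Δ a b d) ≡ s → sign (Δ a b c′ - Δ a b d′) ≡ s → sign (Δ a b i - Δ a b j) ≡ s →
    Δ c d (along a b l) ≡ 0# → Δ c′ d′ (along a b l′) ≡ 0# →
    χ i j (along a b l) ≢ χ c′ d′ (along a b l) →
    χ i j (along a b l′) ≡ χ c d (along a b l′) × χ c d (along a b l′) ≡ ℤ.- χ c′ d′ (along a b l)
  orientations-at-two-crossings {a} {b} {c} {d} {c′} {d′} {i} {j} {s} l l′ s≢0 l′≢l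
    cd≡s c′d′≡s ij≡s y∈cd y′∈c′d′ χij≢χc′d′ =
    ≡.trans χij (≡.sym χcd) , ≡.trans χcd (≡.sym (≡.trans (cong ℤ.-_ χc′d′) (ℤ.neg-involutive σ)))
    where
    τ = sign (l′ - l)
    σ = τ ℤ.* s
    τ≢0 : τ ≢ 0ℤ
    τ≢0 = l′≢l ∘ x∙y⁻¹≈ε⇒x≈y l′ l ∘ sign≡0⇒≡0
    σ≢0 : σ ≢ 0ℤ
    σ≢0 = [ τ≢0 , s≢0 ]′ ∘ ℤ.i*j≡0⇒i≡0∨j≡0 τ
    χcd : χ c d (along a b l′) ≡ σ
    χcd = χ-along-from-line l l′ y∈cd cd≡s
    χc′d′ : χ c′ d′ (along a b l) ≡ ℤ.- σ
    χc′d′ = begin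
      χ c′ d′ (along a b l)    ≡⟨ χ-along-from-line l′ l y′∈c′d′ c′d′≡s ⟩
      sign (l - l′) ℤ.* s      ≡⟨ cong (λ t → sign t ℤ.* s) (⁻¹-anti-homo‿- l′ l) ⟨
      sign (- (l′ - l)) ℤ.* s  ≡⟨ cong (ℤ._* s) (sign-‿ (l′ - l)) ⟩
      ℤ.- τ ℤ.* s              ≡⟨ ℤ.neg-distribˡ-* τ s ⟨
      ℤ.- σ                    ∎
    χij : χ i j (along a b l′) ≡ σ
    χij = χ-along-dominated l l′ ij≡s σ≢0 (χij≢χc′d′ ∘ λ e → ≡.trans e (≡.sym χc′d′))

module AffineHulls (R : RealField) {n} (x : Fin n → Geometry.Point R) where
  open RealField R
  open Geometry R
  open Plane R
  open CommutativeRing (commutativeRing R) using (+-commutativeMonoid; zeroˡ)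
  open FiniteSupport +-commutativeMonoid
  open import Algebra.Properties.CommutativeMonoid.Sum +-commutativeMonoid using (sum)
  open IntegerCoefficientSolver (commutativeRing R) using (solve; _:=_; _:-_; _:+_; con)
  open ≡.≡-Reasoning

  pair : Fin n → Fin n → Subset n
  pair p q = ⁅ p ⁆ ∪ ⁅ q ⁆

  ∈-pair⁺ˡ : ∀ p q → p ∈ pair p q
  ∈-pair⁺ˡ p q = x∈p∪q⁺ (inj₁ (x∈⁅x⁆ p))

  ∈-pair⁺ʳ : ∀ p q → q ∈ pair p q
  ∈-pair⁺ʳ p q = x∈p∪q⁺ (inj₂ (x∈⁅x⁆ q))

  ∈-pair⁻ : ∀ {i} p q → i ∈ pair p q → i ≡ p ⊎ i ≡ q
  ∈-pair⁻ p q i∈ = Sum.map (x∈⁅y⁆⇒x≡y p) (x∈⁅y⁆⇒x≡y q) (x∈p∪q⁻ ⁅ p ⁆ ⁅ q ⁆ i∈)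

  pair-disjoint : ∀ {p q r s} → p ≢ r → p ≢ s → q ≢ r → q ≢ s → Empty (pair p q ∩ pair r s)
  pair-disjoint {p} {q} {r} {s} p≢r p≢s q≢r q≢s (i , i∈) with x∈p∩q⁻ (pair p q) (pair r s) i∈
  ... | i∈pq , i∈rs with ∈-pair⁻ p q i∈pq | ∈-pair⁻ r s i∈rs
  ... | inj₁ refl | inj₁ refl = p≢r refl
  ... | inj₁ refl | inj₂ refl = p≢s refl
  ... | inj₂ refl | inj₁ refl = q≢r refl
  ... | inj₂ refl | inj₂ refl = q≢s refl

  ∑≡sum : ∀ {m} (f : Fin m → Carrier) → ∑ f ≡ sum f
  ∑≡sum {ℕ.zero}  f = refl
  ∑≡sum {ℕ.suc m} f = cong (_+_ (f zero)) (∑≡sum (f ∘ suc))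

  ∑ᵖ-coordinates : ∀ {m} (f : Fin m → Point) → ∑ᵖ f ≡ (∑ (proj₁ ∘ f) , ∑ (proj₂ ∘ f))
  ∑ᵖ-coordinates {ℕ.zero}  f = refl
  ∑ᵖ-coordinates {ℕ.suc m} f = cong (f zero ⊕_) (∑ᵖ-coordinates (f ∘ suc))

  module _ {p q} (p≢q : p ≢ q) (w : Fin n → Carrier) (vanish : ∀ i → i ≢ p → i ≢ q → w i ≡ 0#) where

    ∑-pair : ∑ w ≡ w p + w q
    ∑-pair = ≡.trans (∑≡sum w) (sum-supported-at-pair w p≢q vanish)

    ∑ᵖ-pair : ∑ᵖ (λ i → w i · x i) ≡ (w p · x p) ⊕ (w q · x q)
    ∑ᵖ-pair = ≡.trans (∑ᵖ-coordinates _) (cong₂ _,_ (coordinate proj₁) (coordinate proj₂))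
      where
      coordinate : (π : Point → Carrier) → ∑ (λ i → w i * π (x i)) ≡ w p * π (x p) + w q * π (x q)
      coordinate π = ≡.trans (∑≡sum (λ i → w i * π (x i))) (sum-supported-at-pair _ p≢q
        λ i i≢p i≢q → ≡.trans (cong (_* π (x i)) (vanish i i≢p i≢q)) (zeroˡ _))

  Aff-pair⇒OnLine : ∀ {p q z} → p ≢ q → Aff x (pair p q) z → OnLine (x p) (x q) z
  Aff-pair⇒OnLine {p} {q} {z} p≢q (w , outside≡0 , ∑w≡1 , z≡) = w q , (begin
    z                          ≡⟨ z≡ ⟩
    ∑ᵖ (λ i → w i · x i)       ≡⟨ ∑ᵖ-pair p≢q w vanish ⟩
    (w p · x p) ⊕ (w q · x q)  ≡⟨ affine-pair (x p) (x q) (≡.trans (≡.sym (∑-pair p≢q w vanish)) ∑w≡1) ⟩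
    along (x p) (x q) (w q)    ∎)
    where
    vanish : ∀ i → i ≢ p → i ≢ q → w i ≡ 0#
    vanish i i≢p i≢q = outside≡0 i ([ i≢p , i≢q ]′ ∘ ∈-pair⁻ p q)

  pair-weights : Fin n → Fin n → Carrier → Carrier → Fin n → Carrier
  pair-weights p q u v i with i ≟ᶠ p | i ≟ᶠ q
  ... | yes _ | _     = u
  ... | no _  | yes _ = v
  ... | no _  | no _  = 0#

  pair-weights-at-p : ∀ p q u v → pair-weights p q u v p ≡ u
  pair-weights-at-p p q u v with p ≟ᶠ p
  ... | yes _  = refl
  ... | no p≢p = ⊥-elim (p≢p refl)

  pair-weights-at-q : ∀ {p q} u v → p ≢ q → pair-weights p q u v q ≡ v
  pair-weights-at-q {p} {q} u v p≢q with q ≟ᶠ p | q ≟ᶠ q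
  ... | yes q≡p | _      = ⊥-elim (p≢q (≡.sym q≡p))
  ... | no _    | yes _  = refl
  ... | no _    | no q≢q = ⊥-elim (q≢q refl)

  pair-weights-elsewhere : ∀ {p q i} u v → i ≢ p → i ≢ q → pair-weights p q u v i ≡ 0#
  pair-weights-elsewhere {p} {q} {i} u v i≢p i≢q with i ≟ᶠ p | i ≟ᶠ q
  ... | yes i≡p | _       = ⊥-elim (i≢p i≡p)
  ... | no _    | yes i≡q = ⊥-elim (i≢q i≡q)
  ... | no _    | no _    = refl

  OnLine⇒Aff-pair : ∀ {p q z} → p ≢ q → OnLine (x p) (x q) z → Aff x (pair p q) z
  OnLine⇒Aff-pair {p} {q} {z} p≢q (t , z≡) = w , outside≡0 , ∑w≡1 , z≡∑
    where
    w = pair-weights p q (1# - t) t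
    vanish : ∀ i → i ≢ p → i ≢ q → w i ≡ 0#
    vanish i = pair-weights-elsewhere (1# - t) t
    outside≡0 : ∀ i → i ∉ pair p q → w i ≡ 0#
    outside≡0 i i∉ = vanish i (λ { refl → i∉ (∈-pair⁺ˡ p q) }) (λ { refl → i∉ (∈-pair⁺ʳ p q) })
    wq≡t : w q ≡ t
    wq≡t = pair-weights-at-q (1# - t) t p≢q
    weights-sum : w p + w q ≡ 1#
    weights-sum = ≡.trans (cong₂ _+_ (pair-weights-at-p p q (1# - t) t) wq≡t)
                          (solve 1 (λ t → con 1ℤ :- t :+ t := con 1ℤ) refl t)
    ∑w≡1 : ∑ w ≡ 1#
    ∑w≡1 = ≡.trans (∑-pair p≢q w vanish) weights-sum
    z≡∑ : z ≡ ∑ᵖ (λ i → w i · x i)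
    z≡∑ = begin
      z                          ≡⟨ z≡ ⟩
      along (x p) (x q) t        ≡⟨ cong (along (x p) (x q)) (≡.sym wq≡t) ⟩
      along (x p) (x q) (w q)    ≡⟨ ≡.sym (affine-pair (x p) (x q) weights-sum) ⟩
      (w p · x p) ⊕ (w q · x q)  ≡⟨ ≡.sym (∑ᵖ-pair p≢q w vanish) ⟩
      ∑ᵖ (λ i → w i · x i)       ∎

  pair-line : ∀ {p q} → x p ≢ x q → HasDim (Aff x (pair p q)) (+ 1)
  pair-line xp≢xq = dim-line _ _ xp≢xq λ z → Aff-pair⇒OnLine p≢q , OnLine⇒Aff-pair p≢q
    where
    p≢q = xp≢xq ∘ cong x

module Concurrency (R : RealField) {n} {x : Fin n → Geometry.Point R} (gp : Geometry.StrongGP R x) where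
  open RealField R
  open Geometry R
  open Signs R using (≡0⇒sign≡0)
  open Plane R
  open AffineHulls R x
  open StrongGP gp

  disjoint-lines-not-concurrent : ∀ {a b c d e f y} → PairwiseDistinct4 a b c d → PairwiseDistinct4 a b e f →
    c ≢ e → c ≢ f → d ≢ e → d ≢ f → det (x b ⊖ x a) (x d ⊖ x c) ≢ 0# →
    OnLine (x a) (x b) y → OnLine (x c) (x d) y → OnLine (x e) (x f) y → ⊥
  disjoint-lines-not-concurrent {a} {b} {c} {d} {e} {f} {y}
    (a≢b , a≢c , a≢d , b≢c , b≢d , c≢d) (_ , a≢e , a≢f , b≢e , b≢f , e≢f) c≢e c≢f d≢e d≢f
    nonparallel y∈ab y∈cd y∈ef =
    2≢3 (dimCond lines disjoint _ dims (+ 0) (dim-point y (λ z → meet⇒y z , y⇒meet z)))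
    where
    lines = pair a b ∷ pair c d ∷ pair e f ∷ []
    disjoint : AllPairs (λ F G → Empty (F ∩ G)) lines
    disjoint = (pair-disjoint a≢c a≢d b≢c b≢d ∷ pair-disjoint a≢e a≢f b≢e b≢f ∷ [])
             ∷ (pair-disjoint c≢e c≢f d≢e d≢f ∷ []) ∷ [] ∷ []
    dims : Pointwise (λ F k → HasDim (Aff x F) k) lines (+ 1 ∷ + 1 ∷ + 1 ∷ [])
    dims = pair-line (a≢b ∘ distinct) ∷ pair-line (c≢d ∘ distinct) ∷ pair-line (e≢f ∘ distinct) ∷ []
    meet⇒y : ∀ z → All (λ F → Aff x F z) lines → z ≡ y
    meet⇒y z (z∈ab ∷ z∈cd ∷ _ ∷ []) = meet-unique nonparallel
      (OnLine⇒Δ≡0 (Aff-pair⇒OnLine a≢b z∈ab)) (OnLine⇒Δ≡0 (Aff-pair⇒OnLine c≢d z∈cd))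
      (OnLine⇒Δ≡0 y∈ab) (OnLine⇒Δ≡0 y∈cd)
    y⇒meet : ∀ z → z ≡ y → All (λ F → Aff x F z) lines
    y⇒meet z refl =
      OnLine⇒Aff-pair a≢b y∈ab ∷ OnLine⇒Aff-pair c≢d y∈cd ∷ OnLine⇒Aff-pair e≢f y∈ef ∷ []
    -- the common point has codimension 2, but strong general position demands min(3, 1 + 1 + 1)
    2≢3 : + 2 ≢ + 3
    2≢3 ()

  Δ≢0 : ∀ {i j k} → i ≢ j → j ≢ k → i ≢ k → Δ (x i) (x j) (x k) ≢ 0#
  Δ≢0 {i} {j} {k} i≢j j≢k i≢k = affIndep i j k i≢j j≢k i≢k ∘ ≡0⇒sign≡0

  shared-endpoint-off-ab : ∀ {a b p q r y} → a ≢ b → b ≢ p → a ≢ p → p ≢ q → q ≢ r → p ≢ r →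
    Δ (x p) (x q) y ≡ 0# → Δ (x p) (x r) y ≡ 0# → Δ (x a) (x b) y ≢ 0#
  shared-endpoint-off-ab {a} {b} a≢b b≢p a≢p p≢q q≢r p≢r pqy pry =
    Δ≢0 a≢b b≢p a≢p ∘ subst (λ z → Δ (x a) (x b) z ≡ 0#)
                            (meet-at-common-endpoint (Δ≢0 p≢q q≢r p≢r) pqy pry)

  lines-not-concurrent : ∀ {a b c d c′ d′ y} → PairwiseDistinct4 a b c d → PairwiseDistinct4 a b c′ d′ →
    ¬ ((c ≡ c′ × d ≡ d′) ⊎ (c ≡ d′ × d ≡ c′)) → det (x b ⊖ x a) (x d ⊖ x c) ≢ 0# →
    OnLine (x a) (x b) y → OnLine (x c) (x d) y → OnLine (x c′) (x d′) y → ⊥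
  lines-not-concurrent {a} {b} {c} {d} {c′} {d′}
    abcd@(a≢b , _ , _ , b≢c , b≢d , c≢d) abc′d′@(_ , a≢c′ , a≢d′ , b≢c′ , b≢d′ , c′≢d′)
    different nonparallel y∈ab y∈cd y∈c′d′
    with c ≟ᶠ c′ | c ≟ᶠ d′ | d ≟ᶠ c′ | d ≟ᶠ d′
  ... | yes refl | _ | _ | _ =
    shared-endpoint-off-ab a≢b b≢c a≢c′ c≢d (λ d≡d′ → different (inj₁ (refl , d≡d′))) c′≢d′
      (OnLine⇒Δ≡0 y∈cd) (OnLine⇒Δ≡0 y∈c′d′) (OnLine⇒Δ≡0 y∈ab)
  ... | no _ | yes refl | _ | _ =
    shared-endpoint-off-ab a≢b b≢c a≢d′ c≢d (λ d≡c′ → different (inj₂ (refl , d≡c′))) (c′≢d′ ∘ ≡.sym)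
      (OnLine⇒Δ≡0 y∈cd) (Δ≡0-swap (OnLine⇒Δ≡0 y∈c′d′)) (OnLine⇒Δ≡0 y∈ab)
  ... | no _ | no _ | yes refl | _ =
    shared-endpoint-off-ab a≢b b≢d a≢c′ (c≢d ∘ ≡.sym) (λ c≡d′ → different (inj₂ (c≡d′ , refl))) c′≢d′
      (Δ≡0-swap (OnLine⇒Δ≡0 y∈cd)) (OnLine⇒Δ≡0 y∈c′d′) (OnLine⇒Δ≡0 y∈ab)
  ... | no _ | no _ | no _ | yes refl =
    shared-endpoint-off-ab a≢b b≢d a≢d′ (c≢d ∘ ≡.sym) (λ c≡c′ → different (inj₁ (c≡c′ , refl))) (c′≢d′ ∘ ≡.sym)
      (Δ≡0-swap (OnLine⇒Δ≡0 y∈cd)) (Δ≡0-swap (OnLine⇒Δ≡0 y∈c′d′)) (OnLine⇒Δ≡0 y∈ab)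
  ... | no c≢c′ | no c≢d′ | no d≢c′ | no d≢d′ =
    disjoint-lines-not-concurrent abcd abc′d′ c≢c′ c≢d′ d≢c′ d≢d′ nonparallel y∈ab y∈cd y∈c′d′

module ValidIntersections (R : RealField) (x : Fin 10 → Geometry.Point R) (gp : Geometry.StrongGP R x) where
  open RealField R
  open Geometry R
  open Signs R
  open Plane R
  open Concurrency R gp
  open StrongGP gp
  open ≡.≡-Reasoning

  yI-on-ab : ∀ a b c d → OnLine (x a) (x b) (yI x a b c d)
  yI-on-ab _ _ _ _ = _ , refl

  valid⇒on-segment : ∀ {a b c d} → IsValid x a b c d → InConv (x c) (x d) (yI x a b c d)
  valid⇒on-segment V = proj₂ (proj₂ (proj₁ V _) refl)

  valid⇒on-cd : ∀ {a b c d} → IsValid x a b c d → OnLine (x c) (x d) (yI x a b c d)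
  valid⇒on-cd V with valid⇒on-segment V
  ... | t , _ , _ , y≡ = t , y≡

  valid⇒opposite-sides : ∀ {a b c d} → PairwiseDistinct4 a b c d → IsValid x a b c d →
                         χI x a b d ≡ ℤ.- χI x a b c
  valid⇒opposite-sides {a} {b} {c} {d} (a≢b , a≢c , a≢d , b≢c , b≢d , _) V with valid⇒on-segment V
  ... | t , 0≤t , t≤1 , y≡ = convex≡0⇒opposite-signs 0≤t t≤1 (begin
    (1# - t) * Δ (x a) (x b) (x c) + t * Δ (x a) (x b) (x d)  ≡⟨ Δ-along-convex (x a) (x b) (x c) (x d) t ⟨
    Δ (x a) (x b) (along (x c) (x d) t)                       ≡⟨ cong (Δ (x a) (x b)) y≡ ⟨
    Δ (x a) (x b) (yI x a b c d)                              ≡⟨ OnLine⇒Δ≡0 (yI-on-ab a b c d) ⟩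
    0#                                                        ∎)
    (affIndep a b c a≢b b≢c a≢c) (affIndep a b d a≢b b≢d a≢d)

  valid⇒crossing : ∀ {a b c d} → PairwiseDistinct4 a b c d → IsValid x a b c d →
                   sign (Δ (x a) (x b) (x c) - Δ (x a) (x b) (x d)) ≡ χI x a b c
  valid⇒crossing abcd V = sign-difference refl (valid⇒opposite-sides abcd V)

  valid⇒not-parallel : ∀ {a b c d} → PairwiseDistinct4 a b c d → IsValid x a b c d →
                       det (x b ⊖ x a) (x d ⊖ x c) ≢ 0#
  valid⇒not-parallel {a} {b} {c} {d} abcd@(a≢b , a≢c , _ , b≢c , _) V det≡0 =
    affIndep a b c a≢b b≢c a≢c (ℤ.neg-injective (begin
      ℤ.- χI x a b c                                        ≡⟨ cong ℤ.-_ (valid⇒crossing abcd V) ⟨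
      ℤ.- sign (Δ (x a) (x b) (x c) - Δ (x a) (x b) (x d))  ≡⟨ sign-‿ _ ⟨
      sign (- (Δ (x a) (x b) (x c) - Δ (x a) (x b) (x d)))  ≡⟨ cong sign (det-directions _ _ _ _) ⟨
      sign (det (x b ⊖ x a) (x d ⊖ x c))                    ≡⟨ ≡0⇒sign≡0 det≡0 ⟩
      0ℤ                                                    ∎))

  valid-intersections-distinct : ∀ {a b c d c′ d′} → PairwiseDistinct4 a b c d → PairwiseDistinct4 a b c′ d′ →
    ¬ ((c ≡ c′ × d ≡ d′) ⊎ (c ≡ d′ × d ≡ c′)) → IsValid x a b c d → IsValid x a b c′ d′ →
    yI x a b c d ≢ yI x a b c′ d′
  valid-intersections-distinct {a} {b} {c} {d} {c′} {d′} abcd abc′d′ different V V′ y≡y′ =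
    lines-not-concurrent abcd abc′d′ different (valid⇒not-parallel abcd V)
      (yI-on-ab a b c d) (valid⇒on-cd V) (subst (OnLine (x c′) (x d′)) (≡.sym y≡y′) (valid⇒on-cd V′))

open import Data.Integer using (-_)

proposition4p10 : (R : RealField) → let open Geometry R in
    (x : Fin 10 → Point) → StrongGP x →
    (a b c d c' d' : Fin 10) →
    PairwiseDistinct4 a b c d → PairwiseDistinct4 a b c' d' →
    ¬ ((c ≡ c' × d ≡ d') ⊎ (c ≡ d' × d ≡ c')) →
    IsValid x a b c d → IsValid x a b c' d' →
    χI x a b c ≡ χI x a b c' →
    (i j : Fin 10) → i ≢ j →
    i ≢ a → i ≢ b → i ≢ c' → i ≢ d' →
    j ≢ a → j ≢ b → j ≢ c' → j ≢ d' →
    χI x a b i ≡ χI x a b c → χI x a b c ≡ χI x a b c' →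
    χI x a b j ≡ χI x a b d → χI x a b d ≡ χI x a b d' →
    χ (x i) (x j) (yI x a b c d) ≢ χ (x c') (x d') (yI x a b c d) →
    χ (x i) (x j) (yI x a b c' d') ≢ + 0 →
    (χ (x i) (x j) (yI x a b c' d') ≡ χ (x c) (x d) (yI x a b c' d')) ×
    (χ (x c) (x d) (yI x a b c' d') ≡ - χ (x c') (x d') (yI x a b c d))
proposition4p10 R x gp a b c d c' d' abcd@(a≢b , a≢c , _ , b≢c , _) abc'd' different V V' _
                i j _ _ _ _ _ _ _ _ _ ab-i≡ab-c ab-c≡ab-c' ab-j≡ab-d ab-d≡ab-d' χij≢χc'd' _ =
  -- yI x a b c d unfolds to along (x a) (x b) l, so the parameters l and l′ are inferred
  orientations-at-two-crossings _ _ (affIndep a b c a≢b b≢c a≢c)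
    (valid-intersections-distinct abcd abc'd' different V V' ∘ cong (along (x a) (x b)) ∘ ≡.sym)
    (valid⇒crossing abcd V)
    (sign-difference (≡.sym ab-c≡ab-c') (≡.trans (≡.sym ab-d≡ab-d') ab-d≡-ab-c))
    (sign-difference ab-i≡ab-c (≡.trans ab-j≡ab-d ab-d≡-ab-c))
    (OnLine⇒Δ≡0 (valid⇒on-cd V)) (OnLine⇒Δ≡0 (valid⇒on-cd V'))
    χij≢χc'd'
  where
  open Geometry R
  open Signs R
  open Plane R
  open ValidIntersections R x gp
  open StrongGP gp
  ab-d≡-ab-c : χI x a b d ≡ ℤ.- χI x a b c
  ab-d≡-ab-c = valid⇒opposite-sides abcd V
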